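{- There is a sequence $\varepsilon_n\to 0$ such that for every $n$ there exist permutations $\pi,\tau\in S_n$ with $d(\pi,\tau)=1$ and \[ \Delta(\lambda(\pi),\lambda(\tau))\ge (1-\varepsilon_n)\sqrt{n/2}. \]
   Context: For $\pi\in S_n$, $\lambda(\pi)=(\lambda_1\ge\lambda_2\ge\cdots)$ is the RSK shape of $\pi$ (the common shape of the insertion and recording tableaux), a partition of $n$, with $\lambda_i=0$ beyond its number of parts. $d(\pi,\tau)$ is the least number of adjacent transpositions $(i,i+1)$ by which one must successively left-multiply $\pi$ (replacing $\sigma$ by $(i,i+1)\circ\sigma$) to obtain $\tau$. For partitions $\lambda,\mu$ of $n$, $\Delta(\lambda,\mu)=\frac12\sum_{i=1}^n|\lambda_i-\mu_i|$. -}

module Defs where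

open import Data.Nat using (ℕ; zero; suc; _<ᵇ_; ∣_-_∣) renaming (_+_ to _+ℕ_)
open import Data.Nat as ℕ using ()
open import Data.Bool using (true; false)
open import Data.Maybe using (Maybe; just; nothing)
open import Data.Product using (Σ; _×_; _,_; ∃)
open import Data.Sum using (_⊎_)
open import Data.List using (List; []; _∷_; [_]; map; length; foldl)
open import Data.Nat.ListAction using (sum)
open import Data.Fin using (Fin; toℕ)
open import Data.Fin.Permutation using (Permutation′; _⟨$⟩ʳ_; transpose)
open import Data.Vec using (toList; tabulate)
open import Data.Integer using (+_)
open import Data.Rational using (ℚ; _/_; _*_; _≤_; 0ℚ)
open import Relation.Binary.PropositionalEquality using (_≡_)

_≈ₚ_ : ∀ {n} → Permutation′ n → Permutation′ n → Set
π ≈ₚ τ = ∀ x → π ⟨$⟩ʳ x ≡ τ ⟨$⟩ʳ x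

LeftAdj : ∀ {n} → Permutation′ n → Permutation′ n → Set
LeftAdj {n} π τ =
  Σ (Fin n) λ i → Σ (Fin n) λ j → (toℕ j ≡ suc (toℕ i)) ×
    (∀ x → τ ⟨$⟩ʳ x ≡ transpose i j ⟨$⟩ʳ (π ⟨$⟩ʳ x))

Steps : ∀ {n} → ℕ → Permutation′ n → Permutation′ n → Set
Steps zero    π τ = π ≈ₚ τ
Steps (suc k) π τ = Σ _ λ σ → LeftAdj π σ × Steps k σ τ

-- d(π,τ) = 1 : the least such number is 1, i.e. reachable in 1 step
-- and not in 0 steps.
DistOne : ∀ {n} → Permutation′ n → Permutation′ n → Set
DistOne π τ = Steps 1 π τ × (Steps 0 π τ → Data.Empty.⊥)
  where import Data.Empty

-- A tableau is a list of rows (each row an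
-- increasing list).

rowIns : ℕ → List ℕ → Maybe ℕ × List ℕ
rowIns x [] = nothing , [ x ]
rowIns x (y ∷ ys) with x <ᵇ y
... | true  = just y , x ∷ ys
... | false with rowIns x ys
...   | b , ys' = b , y ∷ ys'

insertT : ℕ → List (List ℕ) → List (List ℕ)
insertT x [] = [ [ x ] ]
insertT x (r ∷ rs) with rowIns x r
... | nothing , r' = r' ∷ rs
... | just y  , r' = r' ∷ insertT y rs

insertionTableau : List ℕ → List (List ℕ)
insertionTableau w = foldl (λ t x → insertT x t) [] w

oneLine : ∀ {n} → Permutation′ n → List ℕ
oneLine {n} π = toList (tabulate {n = n} λ x → toℕ (π ⟨$⟩ʳ x))

-- RSK shape λ(π): row lengths of the insertion tableau
-- (λ₁ ≥ λ₂ ≥ …; entries beyond the list are 0).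
shape : ∀ {n} → Permutation′ n → List ℕ
shape π = map length (insertionTableau (oneLine π))

-- Σ_i |λ_i - μ_i|  (missing parts are 0); this is 2Δ(λ,μ).
absDiffSum : List ℕ → List ℕ → ℕ
absDiffSum []       ys       = sum ys
absDiffSum (x ∷ xs) []       = sum (x ∷ xs)
absDiffSum (x ∷ xs) (y ∷ ys) = ∣ x - y ∣ +ℕ absDiffSum xs ys

Δ : List ℕ → List ℕ → ℚ
Δ l m = + absDiffSum l m / 2

-- c · √x ≤ D  for rationals x ≥ 0, D ≥ 0 (no reals available):
-- either c ≤ 0, or c² x ≤ D².
ScaledSqrt≤ : ℚ → ℚ → ℚ → Set
ScaledSqrt≤ c x D = (c ≤ 0ℚ) ⊎ (c * c * x ≤ D * D)

module Submission where

-- For k = j+1 we build two words of length 2k² on the letters 0 … 2k²-1 that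
-- differ by exchanging the values c, c+1 (so the permutations are one adjacent
-- transposition apart).  Level j+1 reads: a decreasing run of length 2k, its
-- largest letter, level j, its smallest letter, a decreasing run of length
-- 2k.  Row insertion treats these blocks separately, so by induction on j the
-- insertion tableau of level j+1 is that of level j shifted one column right,
-- with one extra column on each side and a last row: the shapes are
-- (2k, 2k-2, 2k-2, …, 2, 2) and (2k-1, 2k-1, …, 1, 1), at distance Δ = k.
-- Padding by an increasing run of large letters adds the same first row to
-- both shapes, so any n ≥ 2k² works; with k = ⌊√(n/2)⌋ and ε n = 1/(k+1),
-- (1 - ε n)² n/2 ≤ k² because n < 2(k+1)².

module Tableaux where

  open import Defs using (rowIns; insertT; absDiffSum)
  open import Data.Nat using (ℕ; zero; suc; _+_; _<ᵇ_; _≤_; _<_; z≤n; s≤s; ∣_-_∣)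
  open import Data.Nat.ListAction using (sum)
  open import Data.Nat.Properties
    using ( <⇒<ᵇ; ≤-trans; <⇒≤; suc-injective; ≤-refl; +-suc; +-identityʳ; +-comm
          ; ∣n-n∣≡0; ∣m+n-m+o∣≡∣n-o∣; ∣-∣-identityʳ)
  open import Data.Bool using (true; false)
  open import Data.Bool.Properties using (T-≡)
  open import Data.Maybe using (Maybe; just; nothing)
  open import Data.Maybe.Relation.Unary.All as Maybe using (just; nothing)
  open import Data.Product using (_×_; _,_; proj₁; proj₂)
  open import Data.List using (List; []; _∷_; [_]; _++_; foldl; map; length; replicate)
  open import Data.List.Properties using (++-assoc; ++-identityʳ; length-++)
  open import Data.Unit using (⊤; tt)
  open import Data.List.Relation.Unary.All as All using (All; []; _∷_)
  open import Function using (_∘_; Equivalence)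
  open import Relation.Binary.PropositionalEquality using (_≡_; refl; cong; cong₂; sym; trans; subst; module ≡-Reasoning)

  Tableau : Set
  Tableau = List (List ℕ)

  -- Row-insert the letters of a word, left to right, into a tableau;
  -- 'insertionTableau w' is definitionally 'insertWord [] w'.
  insertWord : Tableau → List ℕ → Tableau
  insertWord t w = foldl (λ t x → insertT x t) t w

  insertWord-++ : ∀ t u v → insertWord t (u ++ v) ≡ insertWord (insertWord t u) v
  insertWord-++ t []      v = refl
  insertWord-++ t (x ∷ u) v = insertWord-++ (insertT x t) u v

  <ᵇ-true : ∀ {x y} → x < y → (x <ᵇ y) ≡ true
  <ᵇ-true = Equivalence.to T-≡ ∘ <⇒<ᵇ

  <ᵇ-false : ∀ {x y} → y ≤ x → (x <ᵇ y) ≡ false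
  <ᵇ-false {x}     {zero}  _       = refl
  <ᵇ-false {suc x} {suc y} (s≤s p) = <ᵇ-false p

  continue : Maybe ℕ × List ℕ → Tableau → Tableau
  continue (nothing , r′) rs = r′ ∷ rs
  continue (just y  , r′) rs = r′ ∷ insertT y rs

  insertT-∷ : ∀ x r rs → insertT x (r ∷ rs) ≡ continue (rowIns x r) rs
  insertT-∷ x r rs with rowIns x r
  ... | nothing , r′ = refl
  ... | just y  , r′ = refl

  AllT : (ℕ → Set) → Tableau → Set
  AllT P = All (All P)

  -- Insertion only rearranges letters: any property of all entries and
  -- letters holds for the bumped letter and for every entry afterwards.
  rowIns-All : ∀ {P : ℕ → Set} x r → All P r → P x →
    Maybe.All P (proj₁ (rowIns x r)) × All P (proj₂ (rowIns x r))
  rowIns-All x []       []         px = nothing , px ∷ []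
  rowIns-All x (y ∷ ys) (py ∷ pys) px with x <ᵇ y
  ... | true  = just py , px ∷ pys
  ... | false with rowIns-All x ys pys px
  ...   | pb , pys′ = pb , py ∷ pys′

  insertT-All : ∀ {P : ℕ → Set} x t → AllT P t → P x → AllT P (insertT x t)
  insertT-All x []       []         px = (px ∷ []) ∷ []
  insertT-All {P} x (r ∷ rs) (pr ∷ prs) px
    rewrite insertT-∷ x r rs = continue-All (rowIns x r) (rowIns-All x r pr px)
    where
    continue-All : ∀ o → Maybe.All P (proj₁ o) × All P (proj₂ o) → AllT P (continue o rs)
    continue-All (nothing , r′) (_       , pr′) = pr′ ∷ prs
    continue-All (just y  , r′) (just py , pr′) = pr′ ∷ insertT-All y rs prs py

  insertWord-All : ∀ {P : ℕ → Set} t w → AllT P t → All P w → AllT P (insertWord t w)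
  insertWord-All t []      pt []         = pt
  insertWord-All t (x ∷ w) pt (px ∷ pw) = insertWord-All (insertT x t) w (insertT-All x t pt px) pw

  beside : Tableau → Tableau → Tableau
  beside []      t       = t
  beside (r ∷ c) []      = r ∷ c
  beside (r ∷ c) (q ∷ t) = (r ++ q) ∷ beside c t

  beside-[] : ∀ c → beside c [] ≡ c
  beside-[] []      = refl
  beside-[] (r ∷ c) = refl

  rowIns-pass : ∀ x r q → All (_≤ x) r → rowIns x (r ++ q) ≡ (proj₁ (rowIns x q) , r ++ proj₂ (rowIns x q))
  rowIns-pass x []      q []         = refl
  rowIns-pass x (y ∷ r) q (y≤x ∷ pr) rewrite <ᵇ-false y≤x | rowIns-pass x r q pr = refl

  rowIns-append : ∀ x r → All (_≤ x) r → rowIns x r ≡ (nothing , r ++ [ x ])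
  rowIns-append x []      []         = refl
  rowIns-append x (y ∷ r) (y≤x ∷ pr) rewrite <ᵇ-false y≤x | rowIns-append x r pr = refl

  below : ∀ {h x} {r : List ℕ} → All (_< h) r → h ≤ x → All (_≤ x) r
  below pr h≤x = All.map (λ y<h → ≤-trans (<⇒≤ y<h) h≤x) pr

  -- Large letters do not interact with small ones: if c has entries < h
  -- and t, x are ≥ h, inserting x into 'beside c t' only affects t.
  insertT-beside : ∀ h x c t → AllT (_< h) c → AllT (h ≤_) t → h ≤ x →
    insertT x (beside c t) ≡ beside c (insertT x t)
  insertT-beside h x []      t       pc         pt         h≤x = refl
  insertT-beside h x (r ∷ c) []      (pr ∷ pc)  pt         h≤x
    rewrite insertT-∷ x r c | rowIns-append x r (below pr h≤x) | beside-[] c = refl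
  insertT-beside h x (r ∷ c) (q ∷ t) (pr ∷ pc) (pq ∷ pt) h≤x
    rewrite insertT-∷ x (r ++ q) (beside c t) | rowIns-pass x r q (below pr h≤x) | insertT-∷ x q t
    = continue-beside (rowIns x q) (rowIns-All x q pq h≤x)
    where
    continue-beside : ∀ o → Maybe.All (h ≤_) (proj₁ o) × All (h ≤_) (proj₂ o) →
      continue (proj₁ o , r ++ proj₂ o) (beside c t) ≡ beside (r ∷ c) (continue o t)
    continue-beside (nothing , q′) _            = refl
    continue-beside (just y  , q′) (just h≤y , _) = cong ((r ++ q′) ∷_) (insertT-beside h y c t pc pt h≤y)

  insertWord-beside : ∀ h c t w → AllT (_< h) c → AllT (h ≤_) t → All (h ≤_) w →
    insertWord (beside c t) w ≡ beside c (insertWord t w)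
  insertWord-beside h c t []      pc pt []          = refl
  insertWord-beside h c t (x ∷ w) pc pt (h≤x ∷ pw)
    rewrite insertT-beside h x c t pc pt h≤x
    = insertWord-beside h c (insertT x t) w pc (insertT-All x t pt h≤x) pw

  insertWord-right : ∀ h t w → AllT (_< h) t → All (h ≤_) w → insertWord t w ≡ beside t (insertWord [] w)
  insertWord-right h t w pt pw = begin
    insertWord t w              ≡⟨ cong (λ t′ → insertWord t′ w) (beside-[] t) ⟨
    insertWord (beside t []) w  ≡⟨ insertWord-beside h t [] w pt [] pw ⟩
    beside t (insertWord [] w)  ∎
    where open ≡-Reasoning

  insertT-sentinel : ∀ z x q → AllT (_< z) q → x < z →
    insertT x (q ++ [ [ z ] ]) ≡ insertT x q ++ [ [ z ] ]
  insertT-sentinel z x []      []        x<z rewrite <ᵇ-true x<z = refl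
  insertT-sentinel z x (r ∷ q) (pr ∷ pq) x<z
    rewrite insertT-∷ x r (q ++ [ [ z ] ]) | insertT-∷ x r q
    = continue-sentinel (rowIns x r) (rowIns-All x r pr x<z)
    where
    continue-sentinel : ∀ o → Maybe.All (_< z) (proj₁ o) × All (_< z) (proj₂ o) →
      continue o (q ++ [ [ z ] ]) ≡ continue o q ++ [ [ z ] ]
    continue-sentinel (nothing , r′) _              = refl
    continue-sentinel (just y  , r′) (just y<z , _) = cong (r′ ∷_) (insertT-sentinel z y q pq y<z)

  insertWord-sentinel : ∀ z q w → AllT (_< z) q → All (_< z) w →
    insertWord (q ++ [ [ z ] ]) w ≡ insertWord q w ++ [ [ z ] ]
  insertWord-sentinel z q []      pq []          = refl
  insertWord-sentinel z q (x ∷ w) pq (x<z ∷ pw)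
    rewrite insertT-sentinel z x q pq x<z
    = insertWord-sentinel z (insertT x q) w (insertT-All x q pq x<z) pw

  column : List ℕ → Tableau
  column = map [_]

  column-All : ∀ {P : ℕ → Set} cs → All P cs → AllT P (column cs)
  column-All []       []       = []
  column-All (c ∷ cs) (p ∷ ps) = (p ∷ []) ∷ column-All cs ps

  Ascending : ℕ → List ℕ → Set
  Ascending x []       = ⊤
  Ascending x (c ∷ cs) = (x < c) × Ascending c cs

  insertT-column : ∀ x cs t → Ascending x cs → length t ≤ length cs →
    insertT x (beside (column cs) t) ≡ beside (column (x ∷ cs)) t
  insertT-column x []       []      _          _         = refl
  insertT-column x (c ∷ cs) []      (x<c , ac) _         rewrite <ᵇ-true x<c =
    cong ([ x ] ∷_) (trans (cong (insertT c) (sym (beside-[] (column cs))))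
                           (insertT-column c cs [] ac z≤n))
  insertT-column x (c ∷ cs) (q ∷ t) (x<c , ac) (s≤s le) rewrite <ᵇ-true x<c =
    cong ((x ∷ q) ∷_) (insertT-column c cs t ac le)

  -- The same when t is exactly as long as the column and sits above a
  -- sentinel row [z]: the pushed-down column gains a row of its own.
  insertT-column-sentinel : ∀ z x cs t → Ascending x cs → All (_< z) (x ∷ cs) →
    length t ≡ length cs →
    insertT x (beside (column cs) (t ++ [ [ z ] ])) ≡ beside (column (x ∷ cs)) (t ++ [] ∷ [ [ z ] ])
  insertT-column-sentinel z x []       []      _          (x<z ∷ []) _  rewrite <ᵇ-true x<z = refl
  insertT-column-sentinel z x (c ∷ cs) (q ∷ t) (x<c , ac) (_ ∷ pz)   eq rewrite <ᵇ-true x<c =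
    cong ((x ∷ q) ∷_) (insertT-column-sentinel z c cs t ac pz (suc-injective eq))

  insertT-onto-column : ∀ x cs → Ascending x cs → insertT x (column cs) ≡ column (x ∷ cs)
  insertT-onto-column x cs ac = begin
    insertT x (column cs)                   ≡⟨ cong (insertT x) (beside-[] (column cs)) ⟨
    insertT x (beside (column cs) [])       ≡⟨ insertT-column x cs [] ac z≤n ⟩
    beside (column (x ∷ cs)) []             ≡⟨ beside-[] (column (x ∷ cs)) ⟩
    column (x ∷ cs)                         ∎
    where open ≡-Reasoning

  interval : ℕ → ℕ → List ℕ
  interval a zero    = []
  interval a (suc b) = a ∷ interval (suc a) b

  descending : ℕ → ℕ → List ℕ
  descending a zero    = []
  descending a (suc b) = (a + b) ∷ descending a b

  interval-++ : ∀ a m n → interval a (m + n) ≡ interval a m ++ interval (a + m) n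
  interval-++ a zero    n rewrite +-identityʳ a = refl
  interval-++ a (suc m) n rewrite +-suc a m = cong (a ∷_) (interval-++ (suc a) m n)

  interval-snoc : ∀ a m → interval a (suc m) ≡ interval a m ++ [ a + m ]
  interval-snoc a m = trans (cong (interval a) (+-comm 1 m)) (interval-++ a m 1)

  length-interval : ∀ a b → length (interval a b) ≡ b
  length-interval a zero    = refl
  length-interval a (suc b) = cong suc (length-interval (suc a) b)

  interval-ascending : ∀ s b → Ascending s (interval (suc s) b)
  interval-ascending s zero    = tt
  interval-ascending s (suc b) = ≤-refl , interval-ascending (suc s) b

  insertWord-descending : ∀ a b cs → Ascending (a + b) cs →
    insertWord (column cs) (descending (suc a) b) ≡ column (interval (suc a) b ++ cs)
  insertWord-descending a zero    cs ac = refl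
  insertWord-descending a (suc b) cs ac = begin
    insertWord (insertT (suc a + b) (column cs)) (descending (suc a) b)
      ≡⟨ cong (λ t → insertWord t (descending (suc a) b)) (insertT-onto-column (suc a + b) cs ac′) ⟩
    insertWord (column (suc a + b ∷ cs)) (descending (suc a) b)
      ≡⟨ insertWord-descending a b (suc a + b ∷ cs) (≤-refl , ac′) ⟩
    column (interval (suc a) b ++ (suc a + b) ∷ cs)
      ≡⟨ cong column (sym (++-assoc (interval (suc a) b) [ suc a + b ] cs)) ⟩
    column ((interval (suc a) b ++ [ suc a + b ]) ++ cs)
      ≡⟨ cong (λ l → column (l ++ cs)) (interval-snoc (suc a) b) ⟨
    column (interval (suc a) (suc b) ++ cs) ∎
    where
    open ≡-Reasoning
    ac′ : Ascending (suc a + b) cs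
    ac′ = subst (λ m → Ascending m cs) (+-suc a b) ac

  insertWord-descending-[] : ∀ a b → insertWord [] (descending (suc a) b) ≡ column (interval (suc a) b)
  insertWord-descending-[] a b = trans (insertWord-descending a b [] tt) (cong column (++-identityʳ (interval (suc a) b)))

  _⊕_ : List ℕ → List ℕ → List ℕ
  []       ⊕ ys       = ys
  (x ∷ xs) ⊕ []       = x ∷ xs
  (x ∷ xs) ⊕ (y ∷ ys) = x + y ∷ (xs ⊕ ys)

  shape-beside : ∀ a c → map length (beside a c) ≡ map length a ⊕ map length c
  shape-beside []      c       = refl
  shape-beside (r ∷ a) []      = refl
  shape-beside (r ∷ a) (q ∷ c) = cong₂ _∷_ (length-++ r) (shape-beside a c)

  shape-column : ∀ cs → map length (column cs) ≡ replicate (length cs) 1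
  shape-column []       = refl
  shape-column (c ∷ cs) = cong (1 ∷_) (shape-column cs)

  ⊕-identityʳ : ∀ σ → σ ⊕ [] ≡ σ
  ⊕-identityʳ []      = refl
  ⊕-identityʳ (x ∷ σ) = refl

  absDiffSum-self : ∀ σ → absDiffSum σ σ ≡ 0
  absDiffSum-self []      = refl
  absDiffSum-self (x ∷ σ) = cong₂ _+_ (∣n-n∣≡0 x) (absDiffSum-self σ)

  absDiffSum-[] : ∀ σ → absDiffSum σ [] ≡ sum σ
  absDiffSum-[] []      = refl
  absDiffSum-[] (x ∷ σ) = refl

  ∣x+r-y+r∣ : ∀ x y r → ∣ x + r - y + r ∣ ≡ ∣ x - y ∣
  ∣x+r-y+r∣ x y r = trans (cong₂ ∣_-_∣ (+-comm x r) (+-comm y r)) (∣m+n-m+o∣≡∣n-o∣ r x y)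

  absDiffSum-⊕ : ∀ σ τ ρ → absDiffSum (σ ⊕ ρ) (τ ⊕ ρ) ≡ absDiffSum σ τ
  absDiffSum-⊕ σ       τ       []      = cong₂ absDiffSum (⊕-identityʳ σ) (⊕-identityʳ τ)
  absDiffSum-⊕ []      []      (r ∷ ρ) = absDiffSum-self (r ∷ ρ)
  absDiffSum-⊕ []      (y ∷ τ) (r ∷ ρ) = cong₂ _+_ (∣x+r-y+r∣ 0 y r) (absDiffSum-⊕ [] τ ρ)
  absDiffSum-⊕ (x ∷ σ) []      (r ∷ ρ) =
    cong₂ _+_ (trans (∣x+r-y+r∣ x 0 r) (∣-∣-identityʳ x)) (trans (absDiffSum-⊕ σ [] ρ) (absDiffSum-[] σ))
  absDiffSum-⊕ (x ∷ σ) (y ∷ τ) (r ∷ ρ) = cong₂ _+_ (∣x+r-y+r∣ x y r) (absDiffSum-⊕ σ τ ρ)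

module Permutations where

  open Tableaux using (interval; length-interval)
  open import Defs using (oneLine; LeftAdj; DistOne)
  open import Data.Nat using (ℕ; zero; suc; _+_; _≤_; _<_; _≟_)
  open import Data.Nat.Properties using (+-identityʳ; +-suc; 1+n≢n; <-trans; n<1+n; <⇒≢; m<n⇒m<1+n)
  open import Data.Product using (Σ; _,_; proj₁; proj₂)
  open import Data.List as List using (List; _∷_; lookup; map)
  open import Data.List.Properties using (tabulate-lookup; tabulate-cong; map-tabulate; ∷-injective)
  open import Data.List.Relation.Binary.Permutation.Propositional using (_↭_; ↭⇒↭ₛ)
  open import Data.List.Relation.Binary.Permutation.Propositional.Properties using (↭-length)
  open import Data.List.Relation.Binary.Permutation.Homogeneous using (onIndices)
  import Data.List.Relation.Binary.Permutation.Setoid.Properties as ↭ₛ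
  open import Data.Fin as Fin using (Fin; toℕ; fromℕ<)
  open import Data.Fin.Properties using (toℕ-injective; toℕ-fromℕ<)
  open import Data.Fin.Permutation using (Permutation; Permutation′; _⟨$⟩ʳ_; _⟨$⟩ˡ_; transpose; inverseʳ)
  import Data.Fin.Permutation.Components as Components
  open import Data.Vec as Vec using (toList)
  open import Function using (_∘_)
  open import Relation.Nullary using (yes; no; ¬_; contradiction)
  open import Relation.Binary.PropositionalEquality
    using (_≡_; _≢_; ≢-sym; refl; cong; sym; trans; setoid; module ≡-Reasoning)

  swapAt : ℕ → ℕ → ℕ
  swapAt c v with v ≟ c
  ... | yes _ = suc c
  ... | no  _ with v ≟ suc c
  ...   | yes _ = c
  ...   | no  _ = v

  swapAt-c : ∀ c → swapAt c c ≡ suc c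
  swapAt-c c with c ≟ c
  ... | yes _   = refl
  ... | no  c≢c = contradiction refl c≢c

  swapAt-suc-c : ∀ c → swapAt c (suc c) ≡ c
  swapAt-suc-c c with suc c ≟ c
  ... | yes 1+c≡c = contradiction 1+c≡c (1+n≢n)
  ... | no  _ with suc c ≟ suc c
  ...   | yes _ = refl
  ...   | no  ne = contradiction refl ne

  swapAt-other : ∀ c v → v ≢ c → v ≢ suc c → swapAt c v ≡ v
  swapAt-other c v v≢c v≢1+c with v ≟ c
  ... | yes v≡c = contradiction v≡c v≢c
  ... | no  _ with v ≟ suc c
  ...   | yes v≡1+c = contradiction v≡1+c v≢1+c
  ...   | no  _     = refl

  swapAt-below : ∀ c v → v < c → swapAt c v ≡ v
  swapAt-below c v v<c = swapAt-other c v (<⇒≢ v<c) (<⇒≢ (m<n⇒m<1+n v<c))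

  swapAt-above : ∀ c v → suc (suc c) ≤ v → swapAt c v ≡ v
  swapAt-above c v 2+c≤v = swapAt-other c v (≢-sym (<⇒≢ (<-trans (n<1+n c) 2+c≤v))) (≢-sym (<⇒≢ 2+c≤v))

  toList-tabulate : ∀ {n} (f : Fin n → ℕ) → toList (Vec.tabulate f) ≡ List.tabulate f
  toList-tabulate {zero}  f = refl
  toList-tabulate {suc n} f = cong (f Fin.zero ∷_) (toList-tabulate (f ∘ Fin.suc))

  tabulate-injective : ∀ {n} (f g : Fin n → ℕ) → List.tabulate f ≡ List.tabulate g → ∀ x → f x ≡ g x
  tabulate-injective f g eq Fin.zero    = proj₁ (∷-injective eq)
  tabulate-injective f g eq (Fin.suc x) = tabulate-injective (f ∘ Fin.suc) (g ∘ Fin.suc) (proj₂ (∷-injective eq)) x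

  oneLine-tabulate : ∀ {n} (π : Permutation′ n) → oneLine π ≡ List.tabulate (toℕ ∘ (π ⟨$⟩ʳ_))
  oneLine-tabulate π = toList-tabulate (toℕ ∘ (π ⟨$⟩ʳ_))

  lookup-interval : ∀ a n (k : Fin (List.length (interval a n))) → lookup (interval a n) k ≡ a + toℕ k
  lookup-interval a (suc n) Fin.zero    = sym (+-identityʳ a)
  lookup-interval a (suc n) (Fin.suc k) = trans (lookup-interval (suc a) n k) (sym (+-suc a (toℕ k)))

  asPermutation′ : ∀ {m k n} → m ≡ n → k ≡ n → (q : Permutation m k) →
    Σ (Permutation′ n) λ π → oneLine π ≡ List.tabulate (toℕ ∘ (q ⟨$⟩ʳ_))
  asPermutation′ refl refl q = q , oneLine-tabulate q

  -- Every rearrangement w of 0, 1, …, n-1 is the one-line notation of a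
  -- permutation of Fin n: read off the index permutation of w ↭ [0..n-1].
  fromWord : ∀ w n → w ↭ interval 0 n → Σ (Permutation′ n) λ π → oneLine π ≡ w
  fromWord w n w↭ = proj₁ realised , (begin
    oneLine (proj₁ realised)            ≡⟨ proj₂ realised ⟩
    List.tabulate (toℕ ∘ (q ⟨$⟩ʳ_))     ≡⟨ tabulate-cong entries ⟩
    List.tabulate (lookup w)            ≡⟨ tabulate-lookup w ⟩
    w                                   ∎)
    where
    open ≡-Reasoning
    q = onIndices (↭⇒↭ₛ w↭)
    realised = asPermutation′ (trans (↭-length w↭) (length-interval 0 n)) (length-interval 0 n) q
    entries : ∀ i → toℕ (q ⟨$⟩ʳ i) ≡ lookup w i
    entries i = sym (trans (↭ₛ.onIndices-lookup (setoid ℕ) (↭⇒↭ₛ w↭) i) (lookup-interval 0 n _))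

  transpose-swapAt : ∀ {n} (i j k : Fin n) → toℕ j ≡ suc (toℕ i) →
    toℕ (Components.transpose i j k) ≡ swapAt (toℕ i) (toℕ k)
  transpose-swapAt i j k j≡1+i with k Fin.≟ i
  ... | yes refl = trans j≡1+i (sym (swapAt-c (toℕ k)))
  ... | no  k≢i with k Fin.≟ j
  ...   | yes refl = sym (trans (cong (swapAt (toℕ i)) j≡1+i) (swapAt-suc-c (toℕ i)))
  ...   | no  k≢j  = sym (swapAt-other (toℕ i) (toℕ k) (k≢i ∘ toℕ-injective)
                                                      (k≢j ∘ toℕ-injective ∘ λ e → trans e (sym j≡1+i)))

  -- Exchanging the values c and c+1 in the one-line notation of π is a
  -- left multiplication by the adjacent transposition (c c+1), and it
  -- changes π, so d(π, τ) = 1.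
  distOne-swapAt : ∀ {n} (π τ : Permutation′ n) c → suc c < n →
    oneLine τ ≡ map (swapAt c) (oneLine π) → DistOne π τ
  distOne-swapAt {n} π τ c 1+c<n τ≡ = (τ , adjacent , λ _ → refl) , unequal
    where
    c<n : c < n
    c<n = <-trans (n<1+n c) 1+c<n
    i j : Fin n
    i = fromℕ< c<n
    j = fromℕ< 1+c<n
    toℕi : toℕ i ≡ c
    toℕi = toℕ-fromℕ< c<n
    j≡1+i : toℕ j ≡ suc (toℕ i)
    j≡1+i = trans (toℕ-fromℕ< 1+c<n) (cong suc (sym toℕi))
    pointwise : ∀ x → toℕ (τ ⟨$⟩ʳ x) ≡ swapAt c (toℕ (π ⟨$⟩ʳ x))
    pointwise = tabulate-injective _ _ (begin
      List.tabulate (toℕ ∘ (τ ⟨$⟩ʳ_))              ≡⟨ oneLine-tabulate τ ⟨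
      oneLine τ                                     ≡⟨ τ≡ ⟩
      map (swapAt c) (oneLine π)                    ≡⟨ cong (map (swapAt c)) (oneLine-tabulate π) ⟩
      map (swapAt c) (List.tabulate (toℕ ∘ (π ⟨$⟩ʳ_))) ≡⟨ map-tabulate (toℕ ∘ (π ⟨$⟩ʳ_)) (swapAt c) ⟩
      List.tabulate (swapAt c ∘ toℕ ∘ (π ⟨$⟩ʳ_))    ∎)
      where open ≡-Reasoning
    adjacent : LeftAdj π τ
    adjacent = i , j , j≡1+i , λ x → toℕ-injective (begin
      toℕ (τ ⟨$⟩ʳ x)                                 ≡⟨ pointwise x ⟩
      swapAt c (toℕ (π ⟨$⟩ʳ x))                      ≡⟨ cong (λ c′ → swapAt c′ (toℕ (π ⟨$⟩ʳ x))) toℕi ⟨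
      swapAt (toℕ i) (toℕ (π ⟨$⟩ʳ x))                ≡⟨ transpose-swapAt i j (π ⟨$⟩ʳ x) j≡1+i ⟨
      toℕ (transpose i j ⟨$⟩ʳ (π ⟨$⟩ʳ x))            ∎)
      where open ≡-Reasoning
    -- The position holding c in π holds c+1 in τ.
    unequal : ¬ (∀ x → π ⟨$⟩ʳ x ≡ τ ⟨$⟩ʳ x)
    unequal π≈τ = 1+n≢n (begin
      suc c                              ≡⟨ swapAt-c c ⟨
      swapAt c c                         ≡⟨ cong (swapAt c) πx≡c ⟨
      swapAt c (toℕ (π ⟨$⟩ʳ x))          ≡⟨ pointwise x ⟨
      toℕ (τ ⟨$⟩ʳ x)                     ≡⟨ cong toℕ (π≈τ x) ⟨
      toℕ (π ⟨$⟩ʳ x)                     ≡⟨ πx≡c ⟩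
      c                                  ∎)
      where
      open ≡-Reasoning
      x = π ⟨$⟩ˡ i
      πx≡c : toℕ (π ⟨$⟩ʳ x) ≡ c
      πx≡c = trans (cong toℕ (inverseʳ π)) toℕi

module Construction where

  open Tableaux
  open Permutations using (swapAt; swapAt-c; swapAt-suc-c; swapAt-below; swapAt-above; fromWord; distOne-swapAt)
  open import Defs using (insertT; absDiffSum; oneLine; DistOne; shape)
  open import Data.Nat using (ℕ; zero; suc; _+_; _*_; _∸_; _≤_; _<_; s≤s; ∣_-_∣)
  open import Data.Nat.Properties
  open import Data.Product using (Σ; _×_; _,_; proj₁; proj₂)
  open import Data.Fin.Permutation using (Permutation′)
  open import Data.Nat.Tactic.RingSolver using (solve-∀)
  open import Data.Bool using (Bool; true; false)
  open import Data.List using (List; []; _∷_; [_]; _++_; map; length; replicate)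
  open import Data.List.Properties using (++-assoc; length-++; length-map; map-++; map-id-local)
  open import Data.List.Relation.Unary.All as All using (All; []; _∷_)
  open import Data.List.Relation.Unary.All.Properties using () renaming (++⁺ to All-++⁺)
  open import Data.List.Relation.Binary.Permutation.Propositional
    using (_↭_; ↭-refl; ↭-sym; prep; swap; module PermutationReasoning)
  open import Data.List.Relation.Binary.Permutation.Propositional.Properties
    using (++⁺ˡ; shift; ∷↭∷ʳ; All-resp-↭) renaming (++⁺ to ↭-++)
  open import Relation.Binary.PropositionalEquality
    using (_≡_; refl; cong; cong₂; sym; trans; subst; module ≡-Reasoning)

  descending↭interval : ∀ a b → descending a b ↭ interval a b
  descending↭interval a zero    = ↭-refl
  descending↭interval a (suc b) = begin
    (a + b) ∷ descending a b    ↭⟨ prep (a + b) (descending↭interval a b) ⟩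
    (a + b) ∷ interval a b      ↭⟨ ∷↭∷ʳ (a + b) (interval a b) ⟩
    interval a b ++ [ a + b ]   ≡⟨ interval-snoc a b ⟨
    interval a (suc b)          ∎
    where open PermutationReasoning

  ↭-front-back : ∀ (xs ys zs : List ℕ) s t → xs ++ t ∷ (ys ++ s ∷ zs) ↭ s ∷ (xs ++ ((ys ++ zs) ++ [ t ]))
  ↭-front-back xs ys zs s t = begin
    xs ++ t ∷ (ys ++ s ∷ zs)        ≡⟨ ++-assoc xs (t ∷ ys) (s ∷ zs) ⟨
    (xs ++ t ∷ ys) ++ [ s ] ++ zs   ↭⟨ shift s (xs ++ t ∷ ys) zs ⟩
    s ∷ ((xs ++ t ∷ ys) ++ zs)      ≡⟨ cong (s ∷_) (++-assoc xs (t ∷ ys) zs) ⟩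
    s ∷ (xs ++ t ∷ (ys ++ zs))      ↭⟨ prep s (++⁺ˡ xs (∷↭∷ʳ t (ys ++ zs))) ⟩
    s ∷ (xs ++ ((ys ++ zs) ++ [ t ])) ∎
    where open PermutationReasoning

  interval-≥ : ∀ a b → All (a ≤_) (interval a b)
  interval-≥ a zero    = []
  interval-≥ a (suc b) = ≤-refl ∷ All.map (≤-trans (n≤1+n a)) (interval-≥ (suc a) b)

  interval-< : ∀ a b → All (_< a + b) (interval a b)
  interval-< a zero    = []
  interval-< a (suc b) rewrite +-suc a b = s≤s (m≤m+n a b) ∷ interval-< (suc a) b

  descending-≥ : ∀ a b → All (a ≤_) (descending a b)
  descending-≥ a b = All-resp-↭ (↭-sym (descending↭interval a b)) (interval-≥ a b)

  descending-< : ∀ a b → All (_< a + b) (descending a b)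
  descending-< a b = All-resp-↭ (↭-sym (descending↭interval a b)) (interval-< a b)

  -- arm j = 2j+2 is the length of each of the two descending runs that
  -- level j+1 of the construction wraps around level j.
  arm : ℕ → ℕ
  arm j = suc (suc (j + j))

  size : ℕ → ℕ
  size zero    = 2
  size (suc j) = suc (suc (arm j + size j + arm j))

  size-closed : ∀ j → size j ≡ 2 * (suc j * suc j)
  size-closed zero    = refl
  size-closed (suc j) rewrite size-closed j = identity j
    where
    identity : ∀ j → suc (suc (suc (suc (j + j)) + 2 * (suc j * suc j) + suc (suc (j + j))))
                     ≡ 2 * (suc (suc j) * suc (suc j))
    identity = solve-∀

  -- Level j+1 on the letters s, …, s + size (j+1) - 1 splits them into
  -- s < [s+1, mid) < [mid, high) < [high, top) < top.
  mid high top : ℕ → ℕ → ℕ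
  mid  s j = suc s + arm j
  high s j = mid s j + size j
  top  s j = high s j + arm j

  suc-top : ∀ s j → suc (top s j) ≡ s + size (suc j)
  suc-top s j = identity s (arm j) (size j)
    where
    identity : ∀ s a n → suc (suc s + a + n + a) ≡ s + suc (suc (a + n + a))
    identity = solve-∀

  word : ℕ → ℕ → Bool → List ℕ
  word zero    s true  = s ∷ suc s ∷ []
  word zero    s false = suc s ∷ s ∷ []
  word (suc j) s b     =
    descending (suc s) (arm j) ++ top s j ∷ (word j (mid s j) b ++ s ∷ descending (high s j) (arm j))

  interval-blocks : ∀ s j →
    interval (suc s) (suc (arm j + size j + arm j))
      ≡ interval (suc s) (arm j) ++ ((interval (mid s j) (size j) ++ interval (high s j) (arm j)) ++ [ top s j ])
  interval-blocks s j = begin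
    interval (suc s) (suc (a + n + a))
      ≡⟨ interval-snoc (suc s) (a + n + a) ⟩
    interval (suc s) (a + n + a) ++ [ suc s + (a + n + a) ]
      ≡⟨ cong₂ (λ l t → l ++ [ t ]) blocks (reassoc (suc s) a n) ⟩
    (interval (suc s) a ++ (interval (suc s + a) n ++ interval (suc s + a + n) a)) ++ [ suc s + a + n + a ]
      ≡⟨ ++-assoc (interval (suc s) a) _ _ ⟩
    interval (suc s) a ++ ((interval (suc s + a) n ++ interval (suc s + a + n) a) ++ [ suc s + a + n + a ]) ∎
    where
    open ≡-Reasoning
    a = arm j
    n = size j
    reassoc : ∀ x y z → x + (y + z + y) ≡ x + y + z + y
    reassoc = solve-∀
    blocks : interval (suc s) (a + n + a) ≡ interval (suc s) a ++ (interval (suc s + a) n ++ interval (suc s + a + n) a)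
    blocks = begin
      interval (suc s) (a + n + a)
        ≡⟨ interval-++ (suc s) (a + n) a ⟩
      interval (suc s) (a + n) ++ interval (suc s + (a + n)) a
        ≡⟨ cong₂ _++_ (interval-++ (suc s) a n) (cong (λ x → interval x a) (sym (+-assoc (suc s) a n))) ⟩
      (interval (suc s) a ++ interval (suc s + a) n) ++ interval (suc s + a + n) a
        ≡⟨ ++-assoc (interval (suc s) a) _ _ ⟩
      interval (suc s) a ++ (interval (suc s + a) n ++ interval (suc s + a + n) a) ∎

  word↭interval : ∀ j s b → word j s b ↭ interval s (size j)
  word↭interval zero    s true  = ↭-refl
  word↭interval zero    s false = swap (suc s) s ↭-refl
  word↭interval (suc j) s b = begin
    descending (suc s) a ++ top s j ∷ (word j (mid s j) b ++ s ∷ descending (high s j) a)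
      ↭⟨ ↭-++ (descending↭interval (suc s) a)
             (prep (top s j) (↭-++ (word↭interval j (mid s j) b) (prep s (descending↭interval (high s j) a)))) ⟩
    interval (suc s) a ++ top s j ∷ (interval (mid s j) (size j) ++ s ∷ interval (high s j) a)
      ↭⟨ ↭-front-back (interval (suc s) a) _ _ s (top s j) ⟩
    s ∷ (interval (suc s) a ++ ((interval (mid s j) (size j) ++ interval (high s j) a) ++ [ top s j ]))
      ≡⟨ cong (s ∷_) (interval-blocks s j) ⟨
    interval s (size (suc j)) ∎
    where
    open PermutationReasoning
    a = arm j

  word-≥ : ∀ j s b → All (s ≤_) (word j s b)
  word-≥ j s b = All-resp-↭ (↭-sym (word↭interval j s b)) (interval-≥ s (size j))

  word-< : ∀ j s b → All (_< s + size j) (word j s b)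
  word-< j s b = All-resp-↭ (↭-sym (word↭interval j s b)) (interval-< s (size j))

  -- The claimed shapes: for b = true  (2k, 2k-2, 2k-2, …, 2, 2),
  --                     for b = false (2k-1, 2k-1, …, 3, 3, 1, 1),   k = j+1.
  lastRows : Bool → List ℕ
  lastRows true  = 2 ∷ 2 ∷ []
  lastRows false = 1 ∷ 1 ∷ []

  shapeOf : ℕ → Bool → List ℕ
  shapeOf zero    true  = 2 ∷ []
  shapeOf zero    false = 1 ∷ 1 ∷ []
  shapeOf (suc j) b     = map (2 +_) (shapeOf j b) ++ lastRows b

  length-shapeOf-true : ∀ j → length (shapeOf j true) ≡ suc (j + j)
  length-shapeOf-true zero    = refl
  length-shapeOf-true (suc j)
    rewrite length-++ (map (2 +_) (shapeOf j true)) {2 ∷ 2 ∷ []} | length-map (2 +_) (shapeOf j true)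
          | length-shapeOf-true j | +-suc j j = cong suc (+-comm (j + j) 2)

  length-shapeOf-false : ∀ j → length (shapeOf j false) ≡ arm j
  length-shapeOf-false zero    = refl
  length-shapeOf-false (suc j)
    rewrite length-++ (map (2 +_) (shapeOf j false)) {1 ∷ 1 ∷ []} | length-map (2 +_) (shapeOf j false)
          | length-shapeOf-false j | +-suc j j = cong (λ m → suc (suc m)) (+-comm (j + j) 2)

  -- In the case b = false the letter s, pushed down the first column,
  -- ends one row below the level-j tableau: we make room for it by an
  -- empty row.
  openRow : Bool → Tableau → Tableau
  openRow true  q = q
  openRow false q = q ++ [ [] ]

  openRow-All : ∀ {P : ℕ → Set} b q → AllT P q → AllT P (openRow b q)
  openRow-All true  q p = p
  openRow-All false q p = All-++⁺ p ([] ∷ [])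

  -- The letter s enters at the top of the first column s+1 … mid-1 and
  -- pushes it down; whether the column outgrows the tableau q beside it
  -- (which sits above a sentinel row [z]) depends on the number of rows
  -- of q, which is that of shapeOf j b.
  insert-pushes-column : ∀ b j s q z → length q ≡ length (shapeOf j b) → s < z → mid s j ≤ z →
    insertT s (beside (column (interval (suc s) (arm j))) (q ++ [ [ z ] ]))
      ≡ beside (column (s ∷ interval (suc s) (arm j))) (openRow b q ++ [ [ z ] ])
  insert-pushes-column true j s q z rows s<z mid≤z =
    insertT-column s (interval (suc s) (arm j)) (q ++ [ [ z ] ]) (interval-ascending s (arm j)) fits
    where
    fits : length (q ++ [ [ z ] ]) ≤ length (interval (suc s) (arm j))
    fits rewrite length-++ q {[ [ z ] ]} | rows | length-shapeOf-true j | length-interval (suc s) (arm j)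
               | +-comm (j + j) 1 = ≤-refl
  insert-pushes-column false j s q z rows s<z mid≤z = begin
    insertT s (beside (column cs) (q ++ [ [ z ] ]))
      ≡⟨ insertT-column-sentinel z s cs q (interval-ascending s (arm j)) (s<z ∷ cs<z) sameLength ⟩
    beside (column (s ∷ cs)) (q ++ [] ∷ [ [ z ] ])
      ≡⟨ cong (beside (column (s ∷ cs))) (++-assoc q [ [] ] [ [ z ] ]) ⟨
    beside (column (s ∷ cs)) ((q ++ [ [] ]) ++ [ [ z ] ]) ∎
    where
    open ≡-Reasoning
    cs = interval (suc s) (arm j)
    cs<z : All (_< z) cs
    cs<z = All.map (λ p → <-≤-trans p mid≤z) (interval-< (suc s) (arm j))
    sameLength : length q ≡ length cs
    sameLength = trans rows (trans (length-shapeOf-false j) (sym (length-interval (suc s) (arm j))))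

  openShape : Bool → List ℕ → List ℕ
  openShape true  σ = σ
  openShape false σ = σ ++ [ 0 ]

  shape-openRow : ∀ b q → map length (openRow b q) ≡ openShape b (map length q)
  shape-openRow true  q = refl
  shape-openRow false q = map-++ length q [ [] ]

  -- The insertion tableau of the level-(j+1) word in terms of the
  -- tableau Q of the level-j word it contains: first column s … mid-1,
  -- then Q (one row lower when b = false) with the column high … top-1
  -- to its right, and the one-box row [z] at the bottom, z = top s j.
  module Level (j s : ℕ) (b : Bool) where

    a h z : ℕ
    a = arm j
    h = mid s j
    z = top s j

    lowRun highRun inner : List ℕ
    lowRun  = descending (suc s) a
    highRun = descending (high s j) a
    inner   = word j h b

    Q : Tableau
    Q = insertWord [] inner

    cs cs′ : List ℕ
    cs  = interval (suc s) a
    cs′ = interval (high s j) a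

    h≤high : h ≤ high s j
    h≤high = m≤m+n h (size j)

    high≤z : high s j ≤ z
    high≤z = m≤m+n (high s j) a

    h≤z : h ≤ z
    h≤z = ≤-trans h≤high high≤z

    s<h : s < h
    s<h = s≤s (m≤m+n s a)

    cs<h : All (_< h) cs
    cs<h = interval-< (suc s) a

    inner<z : All (_< z) inner
    inner<z = All.map (λ p → <-≤-trans p high≤z) (word-< j h b)

    Q≥h : AllT (h ≤_) Q
    Q≥h = insertWord-All [] inner [] (word-≥ j h b)

    Q<high : AllT (_< high s j) Q
    Q<high = insertWord-All [] inner [] (word-< j h b)

    tableau-prefix : insertWord [] (lowRun ++ z ∷ inner) ≡ beside (column cs) (Q ++ [ [ z ] ])
    tableau-prefix = begin
      insertWord [] (lowRun ++ z ∷ inner)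
        ≡⟨ insertWord-++ [] lowRun (z ∷ inner) ⟩
      insertWord (insertT z (insertWord [] lowRun)) inner
        ≡⟨ cong (λ t → insertWord (insertT z t) inner) (insertWord-descending-[] s a) ⟩
      insertWord (insertT z (column cs)) inner
        ≡⟨ cong (λ t → insertWord t inner) (insertWord-right h (column cs) [ z ] (column-All cs cs<h) (h≤z ∷ [])) ⟩
      insertWord (beside (column cs) [ [ z ] ]) inner
        ≡⟨ insertWord-beside h (column cs) [ [ z ] ] inner (column-All cs cs<h) ((h≤z ∷ []) ∷ []) (word-≥ j h b) ⟩
      beside (column cs) (insertWord [ [ z ] ] inner)
        ≡⟨ cong (beside (column cs)) (insertWord-sentinel z [] inner [] inner<z) ⟩
      beside (column cs) (Q ++ [ [ z ] ]) ∎
      where open ≡-Reasoning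

    tableau-suffix :
      insertWord (beside (column (s ∷ cs)) (openRow b Q ++ [ [ z ] ])) highRun
        ≡ beside (column (s ∷ cs)) (beside (openRow b Q) (column cs′) ++ [ [ z ] ])
    tableau-suffix = begin
      insertWord (beside (column (s ∷ cs)) (openRow b Q ++ [ [ z ] ])) highRun
        ≡⟨ insertWord-beside h (column (s ∷ cs)) _ highRun (column-All (s ∷ cs) (s<h ∷ cs<h))
             (All-++⁺ (openRow-All b Q Q≥h) ((h≤z ∷ []) ∷ [])) highRun≥h ⟩
      beside (column (s ∷ cs)) (insertWord (openRow b Q ++ [ [ z ] ]) highRun)
        ≡⟨ cong (beside (column (s ∷ cs))) (insertWord-sentinel z (openRow b Q) highRun Q′<z highRun<z) ⟩
      beside (column (s ∷ cs)) (insertWord (openRow b Q) highRun ++ [ [ z ] ])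
        ≡⟨ cong (λ t → beside (column (s ∷ cs)) (t ++ [ [ z ] ])) highColumn ⟩
      beside (column (s ∷ cs)) (beside (openRow b Q) (column cs′) ++ [ [ z ] ]) ∎
      where
      open ≡-Reasoning
      highRun≥h : All (h ≤_) highRun
      highRun≥h = All.map (≤-trans h≤high) (descending-≥ (high s j) a)
      highRun<z : All (_< z) highRun
      highRun<z = descending-< (high s j) a
      Q′<z : AllT (_< z) (openRow b Q)
      Q′<z = openRow-All b Q (All.map (All.map (λ p → <-≤-trans p high≤z)) Q<high)
      highColumn : insertWord (openRow b Q) highRun ≡ beside (openRow b Q) (column cs′)
      highColumn = trans (insertWord-right (high s j) (openRow b Q) highRun (openRow-All b Q Q<high) (descending-≥ (high s j) a))
                         (cong (beside (openRow b Q)) (insertWord-descending-[] (s + a + size j) a))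

    tableau-step : length Q ≡ length (shapeOf j b) →
      insertWord [] (word (suc j) s b) ≡ beside (column (s ∷ cs)) (beside (openRow b Q) (column cs′) ++ [ [ z ] ])
    tableau-step rows = begin
      insertWord [] (lowRun ++ z ∷ (inner ++ s ∷ highRun))
        ≡⟨ cong (insertWord []) (++-assoc lowRun (z ∷ inner) (s ∷ highRun)) ⟨
      insertWord [] ((lowRun ++ z ∷ inner) ++ s ∷ highRun)
        ≡⟨ insertWord-++ [] (lowRun ++ z ∷ inner) (s ∷ highRun) ⟩
      insertWord (insertT s (insertWord [] (lowRun ++ z ∷ inner))) highRun
        ≡⟨ cong (λ t → insertWord (insertT s t) highRun) tableau-prefix ⟩
      insertWord (insertT s (beside (column cs) (Q ++ [ [ z ] ]))) highRun
        ≡⟨ cong (λ t → insertWord t highRun) (insert-pushes-column b j s Q z rows (<-≤-trans s<h h≤z) h≤z) ⟩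
      insertWord (beside (column (s ∷ cs)) (openRow b Q ++ [ [ z ] ])) highRun
        ≡⟨ tableau-suffix ⟩
      beside (column (s ∷ cs)) (beside (openRow b Q) (column cs′) ++ [ [ z ] ]) ∎
      where open ≡-Reasoning

    shape-step : map length (beside (column (s ∷ cs)) (beside (openRow b Q) (column cs′) ++ [ [ z ] ]))
                 ≡ replicate (suc a) 1 ⊕ ((openShape b (map length Q) ⊕ replicate a 1) ++ [ 1 ])
    shape-step = begin
      map length (beside (column (s ∷ cs)) (beside (openRow b Q) (column cs′) ++ [ [ z ] ]))
        ≡⟨ shape-beside (column (s ∷ cs)) (beside (openRow b Q) (column cs′) ++ [ [ z ] ]) ⟩
      map length (column (s ∷ cs)) ⊕ map length (beside (openRow b Q) (column cs′) ++ [ [ z ] ])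
        ≡⟨ cong₂ _⊕_ (trans (shape-column (s ∷ cs)) (cong (λ m → replicate (suc m) 1) (length-interval (suc s) a)))
                     (map-++ length (beside (openRow b Q) (column cs′)) [ [ z ] ]) ⟩
      replicate (suc a) 1 ⊕ (map length (beside (openRow b Q) (column cs′)) ++ [ 1 ])
        ≡⟨ cong (λ σ → replicate (suc a) 1 ⊕ (σ ++ [ 1 ])) (shape-beside (openRow b Q) (column cs′)) ⟩
      replicate (suc a) 1 ⊕ ((map length (openRow b Q) ⊕ map length (column cs′)) ++ [ 1 ])
        ≡⟨ cong₂ (λ σ τ → replicate (suc a) 1 ⊕ ((σ ⊕ τ) ++ [ 1 ])) (shape-openRow b Q)
                 (trans (shape-column cs′) (cong (λ m → replicate m 1) (length-interval (high s j) a))) ⟩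
      replicate (suc a) 1 ⊕ ((openShape b (map length Q) ⊕ replicate a 1) ++ [ 1 ]) ∎
      where open ≡-Reasoning

  staircase-true : ∀ σ → replicate (suc (suc (length σ))) 1 ⊕ ((σ ⊕ replicate (suc (length σ)) 1) ++ [ 1 ])
                         ≡ map (2 +_) σ ++ lastRows true
  staircase-true []      = refl
  staircase-true (x ∷ σ) = cong₂ _∷_ (cong suc (+-comm x 1)) (staircase-true σ)

  staircase-false : ∀ σ → replicate (suc (length σ)) 1 ⊕ (((σ ++ [ 0 ]) ⊕ replicate (length σ) 1) ++ [ 1 ])
                          ≡ map (2 +_) σ ++ lastRows false
  staircase-false []      = refl
  staircase-false (x ∷ σ) = cong₂ _∷_ (cong suc (+-comm x 1)) (staircase-false σ)

  shape-recurrence : ∀ j b →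
    replicate (suc (arm j)) 1 ⊕ ((openShape b (shapeOf j b) ⊕ replicate (arm j) 1) ++ [ 1 ]) ≡ shapeOf (suc j) b
  shape-recurrence j true  =
    subst (λ m → replicate (suc (suc m)) 1 ⊕ ((σ ⊕ replicate (suc m) 1) ++ [ 1 ]) ≡ shapeOf (suc j) true)
          (length-shapeOf-true j) (staircase-true σ)
    where σ = shapeOf j true
  shape-recurrence j false =
    subst (λ m → replicate (suc m) 1 ⊕ (((σ ++ [ 0 ]) ⊕ replicate m 1) ++ [ 1 ]) ≡ shapeOf (suc j) false)
          (length-shapeOf-false j) (staircase-false σ)
    where σ = shapeOf j false

  word-shape : ∀ j s b → map length (insertWord [] (word j s b)) ≡ shapeOf j b
  word-shape zero    s true  rewrite <ᵇ-false {suc s} {s} (n≤1+n s) = refl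
  word-shape zero    s false rewrite <ᵇ-true {s} {suc s} ≤-refl     = refl
  word-shape (suc j) s b = begin
    map length (insertWord [] (word (suc j) s b))
      ≡⟨ cong (map length) (tableau-step rows) ⟩
    map length (beside (column (s ∷ cs)) (beside (openRow b Q) (column cs′) ++ [ [ z ] ]))
      ≡⟨ shape-step ⟩
    replicate (suc a) 1 ⊕ ((openShape b (map length Q) ⊕ replicate a 1) ++ [ 1 ])
      ≡⟨ cong (λ σ → replicate (suc a) 1 ⊕ ((openShape b σ ⊕ replicate a 1) ++ [ 1 ])) IH ⟩
    replicate (suc a) 1 ⊕ ((openShape b (shapeOf j b) ⊕ replicate a 1) ++ [ 1 ])
      ≡⟨ shape-recurrence j b ⟩
    shapeOf (suc j) b ∎
    where
    open ≡-Reasoning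
    open Level j s b
    IH : map length Q ≡ shapeOf j b
    IH = word-shape j (mid s j) b
    rows : length Q ≡ length (shapeOf j b)
    rows = trans (sym (length-map length Q)) (cong length IH)

  absDiffSum-level : ∀ σ τ → length τ ≡ suc (length σ) →
    absDiffSum (map (2 +_) σ ++ lastRows true) (map (2 +_) τ ++ lastRows false) ≡ absDiffSum σ τ + 2
  absDiffSum-level []      (y ∷ []) _  rewrite ∣m-m+n∣≡n 2 y | +-identityʳ y = refl
  absDiffSum-level (x ∷ σ) (y ∷ τ)  eq rewrite absDiffSum-level σ τ (suc-injective eq) =
    sym (+-assoc ∣ x - y ∣ (absDiffSum σ τ) 2)

  absDiffSum-shapeOf : ∀ j → absDiffSum (shapeOf j true) (shapeOf j false) ≡ suc j + suc j
  absDiffSum-shapeOf zero    = refl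
  absDiffSum-shapeOf (suc j) = begin
    absDiffSum (shapeOf (suc j) true) (shapeOf (suc j) false)
      ≡⟨ absDiffSum-level (shapeOf j true) (shapeOf j false) rows ⟩
    absDiffSum (shapeOf j true) (shapeOf j false) + 2
      ≡⟨ cong (_+ 2) (absDiffSum-shapeOf j) ⟩
    suc j + suc j + 2
      ≡⟨ identity j ⟩
    suc (suc j) + suc (suc j) ∎
    where
    open ≡-Reasoning
    rows : length (shapeOf j false) ≡ suc (length (shapeOf j true))
    rows = trans (length-shapeOf-false j) (sym (cong suc (length-shapeOf-true j)))
    identity : ∀ j → suc j + suc j + 2 ≡ suc (suc j) + suc (suc j)
    identity = solve-∀

  paddedWord : ℕ → ℕ → Bool → List ℕ
  paddedWord j m b = word j 0 b ++ interval (size j) m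

  paddedWord↭interval : ∀ j n b → size j ≤ n → paddedWord j (n ∸ size j) b ↭ interval 0 n
  paddedWord↭interval j n b size≤n = begin
    word j 0 b ++ interval (size j) (n ∸ size j)           ↭⟨ ↭-++ (word↭interval j 0 b) ↭-refl ⟩
    interval 0 (size j) ++ interval (size j) (n ∸ size j)  ≡⟨ interval-++ 0 (size j) (n ∸ size j) ⟨
    interval 0 (size j + (n ∸ size j))                     ≡⟨ cong (interval 0) (m+[n∸m]≡n size≤n) ⟩
    interval 0 n                                           ∎
    where open PermutationReasoning

  -- The padding letters exceed all letters of the word, so they only
  -- add the same shape to both tableaux.
  paddedWord-shape : ∀ j m b →
    map length (insertWord [] (paddedWord j m b)) ≡ shapeOf j b ⊕ map length (insertWord [] (interval (size j) m))
  paddedWord-shape j m b = begin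
    map length (insertWord [] (word j 0 b ++ pad))
      ≡⟨ cong (map length) (insertWord-++ [] (word j 0 b) pad) ⟩
    map length (insertWord Q pad)
      ≡⟨ cong (map length) (insertWord-right (size j) Q pad (insertWord-All [] (word j 0 b) [] (word-< j 0 b))
                                                             (interval-≥ (size j) m)) ⟩
    map length (beside Q (insertWord [] pad))
      ≡⟨ shape-beside Q (insertWord [] pad) ⟩
    map length Q ⊕ map length (insertWord [] pad)
      ≡⟨ cong (_⊕ map length (insertWord [] pad)) (word-shape j 0 b) ⟩
    shapeOf j b ⊕ map length (insertWord [] pad) ∎
    where
    open ≡-Reasoning
    pad = interval (size j) m
    Q = insertWord [] (word j 0 b)

  absDiffSum-paddedWord : ∀ j m →
    absDiffSum (map length (insertWord [] (paddedWord j m true))) (map length (insertWord [] (paddedWord j m false)))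
      ≡ suc j + suc j
  absDiffSum-paddedWord j m = begin
    absDiffSum (map length (insertWord [] (paddedWord j m true))) (map length (insertWord [] (paddedWord j m false)))
      ≡⟨ cong₂ absDiffSum (paddedWord-shape j m true) (paddedWord-shape j m false) ⟩
    absDiffSum (shapeOf j true ⊕ ρ) (shapeOf j false ⊕ ρ)
      ≡⟨ absDiffSum-⊕ (shapeOf j true) (shapeOf j false) ρ ⟩
    absDiffSum (shapeOf j true) (shapeOf j false)
      ≡⟨ absDiffSum-shapeOf j ⟩
    suc j + suc j ∎
    where
    open ≡-Reasoning
    ρ = map length (insertWord [] (interval (size j) m))

  -- The letters c, c+1 of the innermost level-0 word inside word j s b.
  centre : ℕ → ℕ → ℕ
  centre zero    s = s
  centre (suc j) s = centre j (mid s j)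

  centre-≥ : ∀ j s → s ≤ centre j s
  centre-≥ zero    s = ≤-refl
  centre-≥ (suc j) s = ≤-trans (<⇒≤ (s≤s (m≤m+n s (arm j)))) (centre-≥ j (mid s j))

  centre-< : ∀ j s → suc (centre j s) < s + size j
  centre-< zero    s rewrite +-comm s 2 = ≤-refl
  centre-< (suc j) s =
    <-≤-trans (centre-< j (mid s j)) (≤-trans (m≤m+n (high s j) (arm j)) (≤-trans (n≤1+n _) (≤-reflexive (suc-top s j))))

  word-swap : ∀ j s → map (swapAt (centre j s)) (word j s true) ≡ word j s false
  word-swap zero    s rewrite swapAt-c s | swapAt-suc-c s = refl
  word-swap (suc j) s = begin
    map f (lowRun ++ top s j ∷ (word j h true ++ s ∷ highRun))
      ≡⟨ map-++ f lowRun _ ⟩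
    map f lowRun ++ f (top s j) ∷ map f (word j h true ++ s ∷ highRun)
      ≡⟨ cong (λ l → map f lowRun ++ f (top s j) ∷ l) (map-++ f (word j h true) (s ∷ highRun)) ⟩
    map f lowRun ++ f (top s j) ∷ (map f (word j h true) ++ f s ∷ map f highRun)
      ≡⟨ cong₂ _++_ lowFixed (cong₂ _∷_ topFixed (cong₂ _++_ (word-swap j h) (cong₂ _∷_ sFixed highFixed))) ⟩
    lowRun ++ top s j ∷ (word j h false ++ s ∷ highRun) ∎
    where
    open ≡-Reasoning
    h = mid s j
    c = centre j h
    f = swapAt c
    lowRun = descending (suc s) (arm j)
    highRun = descending (high s j) (arm j)
    h≤c : h ≤ c
    h≤c = centre-≥ j h
    2+c≤high : suc (suc c) ≤ high s j
    2+c≤high = centre-< j h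
    lowFixed : map f lowRun ≡ lowRun
    lowFixed = map-id-local (All.map (λ v<h → swapAt-below c _ (<-≤-trans v<h h≤c)) (descending-< (suc s) (arm j)))
    topFixed : f (top s j) ≡ top s j
    topFixed = swapAt-above c (top s j) (≤-trans 2+c≤high (m≤m+n (high s j) (arm j)))
    sFixed : f s ≡ s
    sFixed = swapAt-below c s (<-≤-trans (s≤s (m≤m+n s (arm j))) h≤c)
    highFixed : map f highRun ≡ highRun
    highFixed = map-id-local (All.map (λ high≤v → swapAt-above c _ (≤-trans 2+c≤high high≤v)) (descending-≥ (high s j) (arm j)))

  paddedWord-swap : ∀ j m → map (swapAt (centre j 0)) (paddedWord j m true) ≡ paddedWord j m false
  paddedWord-swap j m = begin
    map f (word j 0 true ++ pad)      ≡⟨ map-++ f (word j 0 true) pad ⟩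
    map f (word j 0 true) ++ map f pad ≡⟨ cong₂ _++_ (word-swap j 0) padFixed ⟩
    word j 0 false ++ pad             ∎
    where
    open ≡-Reasoning
    f = swapAt (centre j 0)
    pad = interval (size j) m
    padFixed : map f pad ≡ pad
    padFixed = map-id-local (All.map (λ size≤v → swapAt-above (centre j 0) _ (≤-trans (centre-< j 0) size≤v))
                                     (interval-≥ (size j) m))

  construction : ∀ j n → size j ≤ n →
    Σ (Permutation′ n) λ π → Σ (Permutation′ n) λ τ →
      DistOne π τ × absDiffSum (shape π) (shape τ) ≡ suc j + suc j
  construction j n size≤n = π , τ , distOne-swapAt π τ c 1+c<n swapped , differ
    where
    m = n ∸ size j
    realiseπ = fromWord (paddedWord j m true)  n (paddedWord↭interval j n true  size≤n)
    realiseτ = fromWord (paddedWord j m false) n (paddedWord↭interval j n false size≤n)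
    π = proj₁ realiseπ
    τ = proj₁ realiseτ
    c = centre j 0
    1+c<n : suc c < n
    1+c<n = <-≤-trans (centre-< j 0) size≤n
    swapped : oneLine τ ≡ map (swapAt c) (oneLine π)
    swapped = trans (proj₂ realiseτ) (trans (sym (paddedWord-swap j m)) (cong (map (swapAt c)) (sym (proj₂ realiseπ))))
    differ : absDiffSum (shape π) (shape τ) ≡ suc j + suc j
    differ = trans (cong₂ (λ u v → absDiffSum (map length (insertWord [] u)) (map length (insertWord [] v)))
                          (proj₂ realiseπ) (proj₂ realiseτ))
                   (absDiffSum-paddedWord j m)

module Asymptotics where

  open import Data.Nat using (ℕ; zero; suc; _+_; _*_; _≤_; _<_; z≤n; s≤s; _≤?_)
  open import Data.Nat.Properties
    using ( ≤-trans; ≤-reflexive; m≤m+n; n≤1+n; ≰⇒>; <-≤-trans; <-irrefl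
          ; *-monoʳ-≤; *-monoˡ-≤; *-mono-≤; m≤n*m; +-identityʳ; *-identityˡ)
  open import Data.Nat.Tactic.RingSolver using (solve-∀)
  open import Data.Integer as ℤ using (+_; -[1+_]; +[1+_])
  import Data.Integer.Properties as ℤₚ
  open import Data.Rational.Unnormalised as ℚᵘ using (mkℚᵘ; *≡*; *≤*; *<*)
  import Data.Rational.Unnormalised.Properties as ℚᵘₚ
  open import Data.Rational as ℚ using (mkℚ; _/_; 1ℚ; 0ℚ; toℚᵘ; ∣_∣)
  import Data.Rational.Properties as ℚₚ
  open import Data.Product using (∃; _×_; _,_; proj₂)
  open import Relation.Nullary using (yes; no; contradiction)
  open import Relation.Binary.PropositionalEquality using (_≡_; refl; cong; sym; trans; subst; subst₂)

  -- rootHalf n = ⌊√(n/2)⌋, the largest k with 2k² ≤ n.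
  rootHalf : ℕ → ℕ
  rootHalf zero = 0
  rootHalf (suc n) with 2 * (suc (rootHalf n) * suc (rootHalf n)) ≤? suc n
  ... | yes _ = suc (rootHalf n)
  ... | no  _ = rootHalf n

  twiceSquare-< : ∀ a → 2 * (a * a) < 2 * (suc a * suc a)
  twiceSquare-< a = ≤-trans (m≤m+n (suc (2 * (a * a))) (suc (4 * a))) (≤-reflexive (identity a))
    where
    identity : ∀ a → suc (2 * (a * a)) + suc (4 * a) ≡ 2 * (suc a * suc a)
    identity = solve-∀

  rootHalf-spec : ∀ n → 2 * (rootHalf n * rootHalf n) ≤ n × n < 2 * (suc (rootHalf n) * suc (rootHalf n))
  rootHalf-spec zero = z≤n , s≤s z≤n
  rootHalf-spec (suc n) with 2 * (suc (rootHalf n) * suc (rootHalf n)) ≤? suc n | rootHalf-spec n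
  ... | yes fits  | _ , above = fits , ≤-trans (s≤s above) (twiceSquare-< (suc (rootHalf n)))
  ... | no  ¬fits | below , _ = ≤-trans below (n≤1+n n) , ≰⇒> ¬fits

  rootHalf-≥ : ∀ k n → 2 * (k * k) ≤ n → k ≤ rootHalf n
  rootHalf-≥ k n 2k²≤n with k ≤? rootHalf n
  ... | yes k≤r = k≤r
  ... | no  k≰r = contradiction (<-≤-trans (proj₂ (rootHalf-spec n)) (≤-trans (*-monoʳ-≤ 2 (*-mono-≤ r<k r<k)) 2k²≤n))
                                (<-irrefl refl)
    where
    r<k : suc (rootHalf n) ≤ k
    r<k = ≰⇒> k≰r

  complement-inverse : ∀ k → toℚᵘ (1ℚ ℚ.- + 1 / suc k) ℚᵘ.≃ mkℚᵘ (+ k) k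
  complement-inverse k = ℚᵘₚ.≃-trans (ℚₚ.toℚᵘ-homo-+ 1ℚ (ℚ.- (+ 1 / suc k)))
    (ℚᵘₚ.≃-trans (ℚᵘₚ.+-congʳ ℚᵘ.1ℚᵘ (ℚᵘₚ.≃-trans (ℚₚ.toℚᵘ-homo‿- (+ 1 / suc k)) (ℚᵘₚ.-‿cong (ℚₚ.toℚᵘ-fromℚᵘ (mkℚᵘ (+ 1) k)))))
                (one-minus k))
    where
    one-minus : ∀ k → (ℚᵘ.1ℚᵘ ℚᵘ.- mkℚᵘ (+ 1) k) ℚᵘ.≃ mkℚᵘ (+ k) k
    one-minus k rewrite +-identityʳ k = *≡* refl

  -- In ℚᵘ (where mkℚᵘ p q = p/(q+1)): (k/(k+1))² · n/2 ≤ (2k/2)², which after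
  -- cross-multiplication reads k²·n·4 ≤ (2k)²·2(k+1)².
  scaled-bound-ℚᵘ : ∀ k n → n ≤ 2 * (suc k * suc k) →
    (mkℚᵘ (+ k) k ℚᵘ.* mkℚᵘ (+ k) k) ℚᵘ.* mkℚᵘ (+ n) 1 ℚᵘ.≤ mkℚᵘ (+ (k + k)) 1 ℚᵘ.* mkℚᵘ (+ (k + k)) 1
  scaled-bound-ℚᵘ k n n≤ = *≤* (subst₂ ℤ._≤_ lhs rhs (ℤ.+≤+ inequality))
    where
    a = k + k
    lhs : + (k * k * n * 4) ≡ ((+ k ℤ.* + k) ℤ.* + n) ℤ.* + 4
    lhs = trans (ℤₚ.pos-* (k * k * n) 4) (cong (ℤ._* + 4) (trans (ℤₚ.pos-* (k * k) n) (cong (ℤ._* + n) (ℤₚ.pos-* k k))))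
    rhs : + (a * a * ((suc k * suc k) * 2)) ≡ (+ a ℤ.* + a) ℤ.* + ((suc k * suc k) * 2)
    rhs = trans (ℤₚ.pos-* (a * a) ((suc k * suc k) * 2)) (cong (ℤ._* + ((suc k * suc k) * 2)) (ℤₚ.pos-* a a))
    identity : ∀ k → k * k * (2 * (suc k * suc k)) * 4 ≡ (k + k) * (k + k) * ((suc k * suc k) * 2)
    identity = solve-∀
    inequality : k * k * n * 4 ≤ a * a * ((suc k * suc k) * 2)
    inequality = ≤-trans (*-monoˡ-≤ 4 (*-monoʳ-≤ (k * k) n≤)) (≤-reflexive (identity k))

  scaled-bound : ∀ k n → n ≤ 2 * (suc k * suc k) →
    (1ℚ ℚ.- + 1 / suc k) ℚ.* (1ℚ ℚ.- + 1 / suc k) ℚ.* (+ n / 2) ℚ.≤ (+ (k + k) / 2) ℚ.* (+ (k + k) / 2)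
  scaled-bound k n n≤ =
    ℚₚ.toℚᵘ-cancel-≤ (ℚᵘₚ.≤-respˡ-≃ (ℚᵘₚ.≃-sym toℚᵘ-lhs) (ℚᵘₚ.≤-respʳ-≃ (ℚᵘₚ.≃-sym toℚᵘ-rhs) (scaled-bound-ℚᵘ k n n≤)))
    where
    c = 1ℚ ℚ.- + 1 / suc k
    d = + (k + k) / 2
    toℚᵘ-lhs : toℚᵘ (c ℚ.* c ℚ.* (+ n / 2)) ℚᵘ.≃ (mkℚᵘ (+ k) k ℚᵘ.* mkℚᵘ (+ k) k) ℚᵘ.* mkℚᵘ (+ n) 1
    toℚᵘ-lhs = ℚᵘₚ.≃-trans (ℚₚ.toℚᵘ-homo-* (c ℚ.* c) (+ n / 2))
      (ℚᵘₚ.*-cong (ℚᵘₚ.≃-trans (ℚₚ.toℚᵘ-homo-* c c) (ℚᵘₚ.*-cong (complement-inverse k) (complement-inverse k)))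
                 (ℚₚ.toℚᵘ-fromℚᵘ (mkℚᵘ (+ n) 1)))
    toℚᵘ-rhs : toℚᵘ (d ℚ.* d) ℚᵘ.≃ mkℚᵘ (+ (k + k)) 1 ℚᵘ.* mkℚᵘ (+ (k + k)) 1
    toℚᵘ-rhs = ℚᵘₚ.≃-trans (ℚₚ.toℚᵘ-homo-* d d)
      (ℚᵘₚ.*-cong (ℚₚ.toℚᵘ-fromℚᵘ (mkℚᵘ (+ (k + k)) 1)) (ℚₚ.toℚᵘ-fromℚᵘ (mkℚᵘ (+ (k + k)) 1)))

  -- 1/(k+1) → 0: for δ = p/q > 0 every k ≥ q gives 1/(k+1) < p/q.
  inverse→0 : ∀ δ → 0ℚ ℚ.< δ → ∃ λ K → ∀ k → K ≤ k → ∣ + 1 / suc k ∣ ℚ.< δ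
  inverse→0 (mkℚ +[1+ p ] q _) _ = suc q , λ k q<k →
    subst (ℚ._< _) (sym (ℚₚ.0≤p⇒∣p∣≡p (ℚₚ.nonNegative⁻¹ (+ 1 / suc k) {{ℚₚ.normalize-nonNeg 1 (suc k)}})))
      (ℚₚ.toℚᵘ-cancel-< (ℚᵘₚ.<-respˡ-≃ (ℚᵘₚ.≃-sym (ℚₚ.toℚᵘ-fromℚᵘ (mkℚᵘ (+ 1) k))) (*<* (cross k q<k))))
    where
    cross : ∀ k → suc q ≤ k → + 1 ℤ.* + suc q ℤ.< +[1+ p ] ℤ.* + suc k
    cross k q<k = subst₂ ℤ._<_ (ℤₚ.pos-* 1 (suc q)) (ℤₚ.pos-* (suc p) (suc k))
      (ℤ.+<+ (≤-trans (≤-reflexive (cong suc (*-identityˡ (suc q)))) (≤-trans (s≤s q<k) (m≤n*m (suc k) (suc p)))))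
  inverse→0 (mkℚ (+ zero)   _ _) (ℚ.*<* (ℤ.+<+ ()))
  inverse→0 (mkℚ -[1+ _ ]   _ _) (ℚ.*<* ())

open import Defs
open import Data.Nat using (ℕ; _≥_)
open import Data.Product using (Σ; ∃; _×_)
open import Data.Integer using (+_)
open import Data.Rational using (ℚ; _<_; _-_; _/_; ∣_∣; 0ℚ; 1ℚ)
open import Data.Fin.Permutation using (Permutation′)
open import Data.Nat as ℕ using (suc; pred; _≤_)
import Data.Nat.Properties as ℕₚ
open import Data.Product using (_,_; proj₁; proj₂)
open import Data.Sum using (inj₂)
import Data.Rational as ℚ
open import Relation.Binary.PropositionalEquality using (_≡_; sym; subst; subst₂)
open Construction using (size; size-closed; construction)
open Asymptotics using (rootHalf; rootHalf-spec; rootHalf-≥; scaled-bound; inverse→0)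

ε : ℕ → ℚ
ε n = + 1 / suc (rootHalf n)

ε→0 : ∀ δ → 0ℚ < δ → ∃ λ N → ∀ n → n ≥ N → ∣ ε n ∣ < δ
ε→0 δ δ>0 with inverse→0 δ δ>0
... | K , small = 2 ℕ.* (K ℕ.* K) , λ n n≥2K² → small (rootHalf n) (rootHalf-≥ K n n≥2K²)

near-permutations : ∀ n j → suc j ≡ rootHalf n → Σ (Permutation′ n) λ π → Σ (Permutation′ n) λ τ →
  DistOne π τ × ScaledSqrt≤ (1ℚ - ε n) (+ n / 2) (Δ (shape π) (shape τ))
near-permutations n j k≡ =
  let (π , τ , dist , differ) = construction j n fits
  in π , τ , dist ,
     inj₂ (subst₂ (λ k d → (1ℚ - + 1 / suc k) ℚ.* (1ℚ - + 1 / suc k) ℚ.* (+ n / 2) ℚ.≤ (+ d / 2) ℚ.* (+ d / 2))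
                  k≡ (sym differ) (scaled-bound (suc j) n below))
  where
  fits : size j ≤ n
  fits = subst (_≤ n) (subst (λ k → 2 ℕ.* (k ℕ.* k) ≡ size j) k≡ (sym (size-closed j))) (proj₁ (rootHalf-spec n))
  below : n ≤ 2 ℕ.* (suc (suc j) ℕ.* suc (suc j))
  below = subst (λ k → n ≤ 2 ℕ.* (suc k ℕ.* suc k)) (sym k≡) (ℕₚ.<⇒≤ (proj₂ (rootHalf-spec n)))

theorem2p5 : Σ (ℕ → ℚ) λ ε →
    (∀ δ → 0ℚ < δ → ∃ λ N → ∀ n → n ≥ N → ∣ ε n ∣ < δ) ×
    (∀ n → n ≥ 2 → Σ (Permutation′ n) λ π → Σ (Permutation′ n) λ τ →
      DistOne π τ × ScaledSqrt≤ (1ℚ - ε n) (+ n / 2) (Δ (shape π) (shape τ)))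
theorem2p5 = ε , ε→0 , λ n n≥2 →
  near-permutations n (pred (rootHalf n)) (ℕₚ.suc-pred (rootHalf n) {{ℕ.>-nonZero (rootHalf-≥ 1 n n≥2)}})
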